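{- Let $M$ be a finite matroid. If $(T,f)$ is a depth-decomposition of $M$, then there is a depth-decomposition $(T,f')$ of $M$ (with the same rooted tree $T$) such that $f'(e)$ is a leaf of $T$ for every element $e$ of $M$.
   Context: For a rooted tree $T$, $\|T\|$ denotes its number of edges. A depth-decomposition of a finite matroid $M$ with rank function $r$ is a pair $(T,f)$ where $T$ is a rooted tree and $f:M\to V(T)$ is a map such that (1) $r(M)=\|T\|$ and (2) $r(X)\le\|T^*(X)\|$ for every $X\subseteq M$, where $T^*(X)$ is the union of the paths from the root to the vertices of $f(X)$. -}

module Defs where

open import Data.Nat using (ℕ; suc; _+_; _≤_)
open import Data.Fin using (Fin; zero; suc; toℕ)
open import Data.Fin.Subset using (Subset; _∈_; _⊆_; _∪_; _∩_; ∣_∣; ⊤)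
open import Data.Product using (Σ; ∃; _×_; _,_)
open import Function.Bundles using (_⇔_)
open import Relation.Binary.PropositionalEquality using (_≡_; _≢_)

record Matroid (n : ℕ) : Set where
  field
    rank    : Subset n → ℕ
    bounded : ∀ X → rank X ≤ ∣ X ∣
    mono    : ∀ {X Y} → X ⊆ Y → rank X ≤ rank Y
    submod  : ∀ X Y → rank (X ∪ Y) + rank (X ∩ Y) ≤ rank X + rank Y
open Matroid public

-- A rooted tree with k edges: vertex set Fin (suc k), root = zero,
-- and every non-root vertex  suc i  has parent  par i , whose index is
-- strictly smaller than that of  suc i  (every rooted tree has such a labelling).
record RootedTree (k : ℕ) : Set where
  field
    par     : Fin k → Fin (suc k)
    par-lt  : ∀ i → toℕ (par i) ≤ toℕ i
open RootedTree public

‖_‖ : ∀ {k} → RootedTree k → ℕ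
‖_‖ {k} _ = k

root : ∀ {k} → Fin (suc k)
root = zero

data Anc {k : ℕ} (T : RootedTree k) (u : Fin (suc k)) : Fin (suc k) → Set where
  here : Anc T u u
  up   : ∀ {i} → Anc T u (par T i) → Anc T u (suc i)

Leaf : ∀ {k} → RootedTree k → Fin (suc k) → Set
Leaf T v = ∀ i → par T i ≢ v

-- ‖T*(X)‖ : number of edges of the union of root-paths to f(X).
-- Each non-root vertex  suc i  of T*(X) contributes exactly one edge (to its parent),
-- so ‖T*(X)‖ = ∣ S ∣ where S is the (uniquely determined) set of i : Fin k
-- with  suc i  on a root path to some f(e), e ∈ X.
IsTStarEdges : ∀ {n k} → RootedTree k → (Fin n → Fin (suc k)) → Subset n → Subset k → Set
IsTStarEdges T f X S = ∀ i → (i ∈ S) ⇔ (∃ λ e → e ∈ X × Anc T (suc i) (f e))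

RankBound : ∀ {n k} → Matroid n → RootedTree k → (Fin n → Fin (suc k)) → Subset n → Set
RankBound {n} {k} M T f X = Σ (Subset k) λ S → IsTStarEdges T f X S × rank M X ≤ ∣ S ∣

IsDepthDecomposition : ∀ {n k} → Matroid n → (T : RootedTree k) → (Fin n → Fin (suc k)) → Set
IsDepthDecomposition M T f = (rank M ⊤ ≡ ‖ T ‖) × (∀ X → RankBound M T f X)

-- Moving each f(e) down to a leaf below it only enlarges every T*(X), since the
-- root path of f(e) is contained in that of the leaf; hence r(X) ≤ ‖T*(X)‖ is
-- preserved, and the tree (so r(M) = ‖T‖) is untouched.  A leaf below v exists:
-- take the descendant of v with the largest label, as children have larger labels
-- than their parents.

module Submission where

open import Defs
open import Data.Bool using (true)
open import Data.Nat using (ℕ; zero; suc; z≤n; s≤s) renaming (_≤_ to _≤ℕ_)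
open import Data.Nat.Properties using (≤-trans; ≤-refl; <⇒≱)
open import Data.Fin using (Fin; zero; suc; toℕ; _≟_) renaming (_≤_ to _≤ᶠ_)
open import Data.Fin.Subset using (Subset; _∈_; _⊆_)
open import Data.Fin.Subset.Properties using (_∈?_; p⊆q⇒∣p∣≤∣q∣)
open import Data.Fin.Properties using (any?)
open import Data.Vec using (tabulate; lookup)
open import Data.Vec.Properties using (lookup∘tabulate; []=⇒lookup; lookup⇒[]=)
open import Data.Product using (Σ; ∃; _×_; _,_; proj₁; proj₂)
open import Data.Empty using (⊥-elim)
open import Function using (_∘_)
open import Function.Bundles using (_⇔_; mk⇔; Equivalence)
open import Relation.Nullary using (Dec; yes; no; does)
open import Relation.Nullary.Decidable using (_×-dec_; dec-true)
open import Level using (0ℓ)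
open import Relation.Unary using (Pred; Decidable; Satisfiable)
open import Relation.Binary.PropositionalEquality using (_≡_; refl; sym; trans)

characteristic : ∀ {k} {P : Pred (Fin k) 0ℓ} → Decidable P → Subset k
characteristic P? = tabulate (does ∘ P?)

∈-characteristic : ∀ {k} {P : Pred (Fin k) 0ℓ} (P? : Decidable P) i → i ∈ characteristic P? ⇔ P i
∈-characteristic {P = P} P? i = mk⇔ (does-true (P? i) ∘ lookup-true) (lookup⇒[]= i _ ∘ lookup-does)
  where
  does-true : ∀ {A : Set} (a? : Dec A) → does a? ≡ true → A
  does-true (yes a) _ = a
  lookup-true : i ∈ characteristic P? → does (P? i) ≡ true
  lookup-true m = trans (sym (lookup∘tabulate (does ∘ P?) i)) ([]=⇒lookup m)
  lookup-does : P i → lookup (characteristic P?) i ≡ true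
  lookup-does p = trans (lookup∘tabulate (does ∘ P?) i) (dec-true (P? i) p)

max-satisfying : ∀ {m} {P : Pred (Fin m) 0ℓ} → Decidable P → Satisfiable P →
                 ∃ λ u → P u × (∀ w → P w → w ≤ᶠ u)
max-satisfying {suc m} P? (v , pv) with any? (P? ∘ suc)
... | yes ex with u , pu , u-max ← max-satisfying (P? ∘ suc) ex
  = suc u , pu , λ { zero _ → z≤n ; (suc w) pw → s≤s (u-max w pw) }
max-satisfying {suc m} P? (zero , pv) | no ¬ex =
  zero , pv , λ { zero _ → z≤n ; (suc w) pw → ⊥-elim (¬ex (w , pw)) }
max-satisfying {suc m} P? (suc v , pv) | no ¬ex = ⊥-elim (¬ex (v , pv))

module _ {k : ℕ} (T : RootedTree k) where

  anc-trans : ∀ {a b c} → Anc T a b → Anc T b c → Anc T a c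
  anc-trans p here   = p
  anc-trans p (up q) = up (anc-trans p q)

  -- Recursion on a bound d ≥ toℕ v, which decreases along parents by par-lt.
  anc?-bounded : ∀ u d v → toℕ v ≤ℕ d → Dec (Anc T u v)
  anc?-bounded u d zero _ with u ≟ zero
  ... | yes refl = yes here
  ... | no u≢0   = no λ { here → u≢0 refl }
  anc?-bounded u (suc d) (suc i) (s≤s i≤d) with u ≟ suc i
  ... | yes refl = yes here
  ... | no u≢v with anc?-bounded u d (par T i) (≤-trans (par-lt T i) i≤d)
  ...   | yes a = yes (up a)
  ...   | no ¬a = no λ { here → u≢v refl ; (up a) → ¬a a }

  anc? : ∀ u → Decidable (Anc T u)
  anc? u v = anc?-bounded u (toℕ v) v ≤-refl

  leaf-below : ∀ v → ∃ λ u → Anc T v u × Leaf T u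
  leaf-below v with u , v≼u , u-max ← max-satisfying (anc? v) (v , here)
    = u , v≼u , λ { i refl → <⇒≱ (s≤s (par-lt T i)) (u-max (suc i) (up v≼u)) }

module _ {n k : ℕ} (T : RootedTree k) where

  tstar-edges : (f : Fin n → Fin (suc k)) (X : Subset n) → ∃ (IsTStarEdges T f X)
  tstar-edges f X = characteristic reaches? , ∈-characteristic reaches?
    where
    reaches? : Decidable (λ i → ∃ λ e → e ∈ X × Anc T (suc i) (f e))
    reaches? i = any? (λ e → (e ∈? X) ×-dec anc? T (suc i) (f e))

  tstar-edges-mono : ∀ {f g : Fin n → Fin (suc k)} {X S S′} →
                     (∀ e → Anc T (f e) (g e)) → IsTStarEdges T f X S → IsTStarEdges T g X S′ → S ⊆ S′
  tstar-edges-mono f≼g isS isS′ {i} i∈S with Equivalence.to (isS i) i∈S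
  ... | e , e∈X , a = Equivalence.from (isS′ i) (e , e∈X , anc-trans T a (f≼g e))

  rankBound-descend : ∀ {M : Matroid n} {f g : Fin n → Fin (suc k)} {X} →
                      (∀ e → Anc T (f e) (g e)) → RankBound M T f X → RankBound M T g X
  rankBound-descend {g = g} {X} f≼g (S , isS , r≤S) with S′ , isS′ ← tstar-edges g X
    = S′ , isS′ , ≤-trans r≤S (p⊆q⇒∣p∣≤∣q∣ (tstar-edges-mono f≼g isS isS′))

lemma7 : ∀ {n k} (M : Matroid n) (T : RootedTree k) (f : Fin n → Fin (suc k))
         → IsDepthDecomposition M T f
         → Σ (Fin n → Fin (suc k)) λ f′ → IsDepthDecomposition M T f′ × (∀ e → Leaf T (f′ e))
lemma7 {n} {k} M T f (rank≡ , bounds) =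
  f′ , (rank≡ , rankBound-descend T {M} f≼f′ ∘ bounds) , proj₂ ∘ proj₂ ∘ leaf-below T ∘ f
  where
  f′ : Fin n → Fin (suc k)
  f′ = proj₁ ∘ leaf-below T ∘ f
  f≼f′ : ∀ e → Anc T (f e) (f′ e)
  f≼f′ = proj₁ ∘ proj₂ ∘ leaf-below T ∘ f
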